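{- Let $G$ be an $r$-regular graph with $k$ vertices, and for $d\ge 1$ let $G^d$ denote the join of $d$ identical copies of $G$. Then there exists a natural number $d_0$ such that $G^d$ is a Ramanujan graph for all $d\ge d_0$.
   Context: Graphs are finite, simple and undirected. The join of graphs $G_1,\dots,G_d$ is obtained from their disjoint union by adding an edge between every vertex of $G_i$ and every vertex of $G_j$ for all $i\neq j$. A connected $r$-regular graph with adjacency eigenvalues $\lambda_1=r\ge\lambda_2\ge\dots\ge\lambda_n$ is Ramanujan if $\max_{|\lambda_i|<r}|\lambda_i|\le 2\sqrt{r-1}$. -}

module Defs where

open import Level using (Level; _⊔_; suc; 0ℓ)
open import Data.Nat as ℕ using (ℕ; zero)
open import Data.Bool using (Bool; true; false; if_then_else_)
open import Data.Fin as Fin using (Fin; remQuot; _≟_)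
open import Data.List using (List; []; _∷_; allFin; foldr; map)
open import Data.Product using (Σ; ∃; ∃-syntax; Σ-syntax; _×_; _,_)
open import Relation.Nullary using (¬_; does; yes; no)
open import Data.Empty using (⊥-elim)
open import Data.Sum using (_⊎_)
open import Relation.Binary.PropositionalEquality using (_≡_; refl; sym)
open import Relation.Binary.Structures using (IsStrictTotalOrder)
open import Relation.Binary.Construct.Closure.ReflexiveTransitive using (Star)
open import Algebra.Bundles using (CommutativeRing)

record Graph (n : ℕ) : Set where
  field
    adj       : Fin n → Fin n → Bool
    symmetric : ∀ i j → adj i j ≡ adj j i
    loopless  : ∀ i → adj i i ≡ false
open Graph public

degree : ∀ {n} → Graph n → Fin n → ℕ
degree {n} G i = foldr ℕ._+_ 0 (map (λ j → if adj G i j then 1 else 0) (allFin n))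

Regular : ∀ {n} → Graph n → ℕ → Set
Regular G r = ∀ i → degree G i ≡ r

Edge : ∀ {n} → Graph n → Fin n → Fin n → Set
Edge G i j = adj G i j ≡ true

Connected : ∀ {n} → Graph n → Set
Connected {n} G = ∀ (i j : Fin n) → Star (Edge G) i j

-- Join of d identical copies of G (vertex (a , u) with a : Fin d copy index,
-- u : Fin k vertex of G, encoded in Fin (d * k) via remQuot)

jadj : ∀ {d k} → Graph k → Fin d × Fin k → Fin d × Fin k → Bool
jadj G (a , u) (b , v) = if does (a ≟ b) then adj G u v else true

jadj-sym : ∀ {d k} (G : Graph k) (x y : Fin d × Fin k) → jadj G x y ≡ jadj G y x
jadj-sym G (a , u) (b , v) with a ≟ b | b ≟ a
... | yes refl | yes _ = symmetric G u v
... | yes p    | no q  = ⊥-elim (q (sym p))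
... | no p     | yes q = ⊥-elim (p (sym q))
... | no _     | no _  = refl

jadj-loop : ∀ {d k} (G : Graph k) (x : Fin d × Fin k) → jadj G x x ≡ false
jadj-loop G (a , u) with a ≟ a
... | yes _ = loopless G u
... | no p  = ⊥-elim (p refl)

join : ∀ {k} (d : ℕ) → Graph k → Graph (d ℕ.* k)
join {k} d G = record
  { adj       = λ x y → jadj G (remQuot {d} k x) (remQuot {d} k y)
  ; symmetric = λ x y → jadj-sym G (remQuot {d} k x) (remQuot {d} k y)
  ; loopless  = λ x → jadj-loop G (remQuot {d} k x)
  }

-- Ordered fields (ℝ is one).  Adjacency eigenvalues are taken in an
-- arbitrary ordered field F.

record OrderedField (c ℓ₁ ℓ₂ : Level) : Set (suc (c ⊔ ℓ₁ ⊔ ℓ₂)) where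
  field
    commutativeRing : CommutativeRing c ℓ₁
  open CommutativeRing commutativeRing public
  field
    _<_               : Carrier → Carrier → Set ℓ₂
    isStrictTotalOrder : IsStrictTotalOrder _≈_ _<_
    0≉1               : ¬ (0# ≈ 1#)
    inverse           : ∀ x → ¬ (x ≈ 0#) → ∃[ y ] (x * y ≈ 1#)
    +-mono-<          : ∀ {x y} z → x < y → (x + z) < (y + z)
    *-pos             : ∀ {x y} → 0# < x → 0# < y → 0# < (x * y)

  _≤_ : Carrier → Carrier → Set (ℓ₁ ⊔ ℓ₂)
  x ≤ y = (x < y) ⊎ (x ≈ y)

  fromℕ : ℕ → Carrier
  fromℕ zero      = 0#
  fromℕ (ℕ.suc m) = 1# + fromℕ m

  ∑ : ∀ n → (Fin n → Carrier) → Carrier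
  ∑ n f = foldr _+_ 0# (map f (allFin n))

module _ {c ℓ₁ ℓ₂} (F : OrderedField c ℓ₁ ℓ₂) where
  open OrderedField F

  adjMatrix : ∀ {n} → Graph n → Fin n → Fin n → Carrier
  adjMatrix G i j = if adj G i j then 1# else 0#

  IsEigenvalue : ∀ {n} → Graph n → Carrier → Set (c ⊔ ℓ₁)
  IsEigenvalue {n} G λ′ =
    Σ[ x ∈ (Fin n → Carrier) ] ((¬ (∀ i → x i ≈ 0#)) ×
            (∀ i → ∑ n (λ j → adjMatrix G i j * x j) ≈ λ′ * x i))

  -- Ramanujan: connected, r-regular, and every eigenvalue λ with |λ| < r
  -- satisfies |λ| ≤ 2√(r-1), i.e. λ² ≤ 4(r-1)
  IsRamanujan : ∀ {n} → Graph n → Set (c ⊔ ℓ₁ ⊔ ℓ₂)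
  IsRamanujan {n} G = Connected G × ∃[ r ] (Regular G r ×
    (∀ λ′ → IsEigenvalue G λ′ →
       (- fromℕ r) < λ′ → λ′ < fromℕ r →
       (λ′ * λ′) ≤ fromℕ (4 ℕ.* (r ℕ.∸ 1))))

{-# OPTIONS --safe #-}
module Submission where

-- Let G^d have n = d k vertices and degree R = r + (d − 1) k.  An eigenvector
-- x of an R-regular graph for an eigenvalue λ ≠ R sums to zero, hence
-- (J − A) x = − λ x.  The matrix J − A is nonnegative with row sums n − R, so
-- evaluating at an entry of x of largest absolute value gives |λ| ≤ n − R.
-- For G^d this is k − r ≤ k, while R − 1 ≥ k² once d ≥ k² + 2; and G^d is
-- connected as soon as d ≥ 2.

open import Defs
open import Level using (0ℓ)
open import Algebra.Bundles using (Monoid)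
open import Data.Bool using (Bool; true; false; not; if_then_else_)
open import Data.Empty using (⊥-elim)
open import Data.Fin using (Fin; zero; suc; _↑ˡ_; _↑ʳ_; combine; remQuot; quotient; punchIn)
open import Data.Fin.Properties using (_≟_; remQuot-combine; punchInᵢ≢i)
open import Data.List using (foldr; map; allFin; tabulate)
open import Data.List.Properties using (map-tabulate)
open import Data.List.Membership.Propositional.Properties using (∈-allFin)
import Data.List.Relation.Unary.All as All
open import Data.Nat as ℕ using (ℕ; zero; suc; _∸_; s≤s)
import Data.Nat.Properties as ℕ
open import Data.Product using (∃-syntax; _×_; _,_; proj₁; proj₂)
open import Data.Sum using (_⊎_; inj₁; inj₂)
import Data.Vec.Functional as Vector
open import Function using (_∘_; id)
open import Relation.Binary.Definitions using (tri<; tri≈; tri>)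
open import Relation.Binary.Bundles using (StrictTotalOrder; DecTotalOrder)
open import Relation.Binary.Construct.Closure.ReflexiveTransitive using (ε; _◅_)
open import Relation.Binary.PropositionalEquality as ≡ using (_≡_; _≢_; cong)
open import Relation.Nullary using (¬_; does; yes; no)
open import Relation.Nullary.Decidable using (dec-false)
import Algebra.Properties.CommutativeMonoid.Sum ℕ.+-0-commutativeMonoid as ℕΣ

foldr-tabulate : ∀ {a b} {A : Set a} {B : Set b} (_∙_ : A → B → B) (e : B) n (f : Fin n → A) →
                 foldr _∙_ e (tabulate f) ≡ Vector.foldr _∙_ e f
foldr-tabulate _∙_ e zero    f = ≡.refl
foldr-tabulate _∙_ e (suc n) f = cong (f zero ∙_) (foldr-tabulate _∙_ e n (f ∘ suc))

foldr-map-allFin : ∀ {a b} {A : Set a} {B : Set b} (_∙_ : A → B → B) (e : B) n (f : Fin n → A) →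
                   foldr _∙_ e (map f (allFin n)) ≡ Vector.foldr _∙_ e f
foldr-map-allFin _∙_ e n f = ≡.trans (cong (foldr _∙_ e) (map-tabulate id f)) (foldr-tabulate _∙_ e n f)

module MonoidSum {a ℓ} (M : Monoid a ℓ) where
  open Monoid M
  open import Algebra.Properties.Monoid.Sum M using (sum; sum-cong-≗)

  sum-↑ˡ-↑ʳ : ∀ m {n} (f : Fin (m ℕ.+ n) → Carrier) →
          sum f ≈ sum (f ∘ (_↑ˡ n)) ∙ sum (f ∘ (m ↑ʳ_))
  sum-↑ˡ-↑ʳ zero    f = sym (identityˡ (sum f))
  sum-↑ˡ-↑ʳ (suc m) f = trans (∙-congˡ (sum-↑ˡ-↑ʳ m (f ∘ suc))) (sym (assoc _ _ _))

  sum-combine : ∀ m {n} (f : Fin (m ℕ.* n) → Carrier) →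
                sum f ≈ sum (λ i → sum (λ j → f (combine {m} {n} i j)))
  sum-combine zero    f = refl
  sum-combine (suc m) {n} f = trans (sum-↑ˡ-↑ʳ n f) (∙-congˡ (sum-combine m (f ∘ (n ↑ʳ_))))

  sum-remQuot : ∀ m {n} (g : Fin m × Fin n → Carrier) →
                sum (g ∘ remQuot {m} n) ≈ sum {m} (λ i → sum {n} (λ j → g (i , j)))
  sum-remQuot m g = trans (sum-combine m _)
    (reflexive (sum-cong-≗ λ i → sum-cong-≗ λ j → cong g (remQuot-combine i j)))

module OrderedFieldProperties {c ℓ₁ ℓ₂} (F : OrderedField c ℓ₁ ℓ₂) where
  open OrderedField F hiding (_<_; _≤_; zero)
  open import Algebra.Properties.Ring ring
    using (-‿distribˡ-*; -‿distribʳ-*; -0#≈0#; -‿involutive; -1*x≈-x;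
           x∙y⁻¹≈ε⇒x≈y; x≈y⇒x∙y⁻¹≈ε; [y-z]x≈yx-zx)
  open import Algebra.Properties.Semiring.Sum semiring public
    using (sum; sum-cong-≋; ∑-comm; ∑-distrib-+; *-distribˡ-sum; *-distribʳ-sum)

  strictTotalOrder : StrictTotalOrder c ℓ₁ ℓ₂
  strictTotalOrder = record { isStrictTotalOrder = isStrictTotalOrder }

  open StrictTotalOrder strictTotalOrder public using (_<_)
  open StrictTotalOrder strictTotalOrder
    using (compare; <-respˡ-≈; <-respʳ-≈; strictPartialOrder) renaming (irrefl to <-irrefl)
  open import Relation.Binary.Properties.StrictTotalOrder strictTotalOrder using (decTotalOrder)
  open DecTotalOrder decTotalOrder public using (_≤_) renaming (refl to ≤-refl)
  open DecTotalOrder decTotalOrder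
    using (totalOrder; total; ≤-respˡ-≈; ≤-respʳ-≈)
    renaming (reflexive to ≤-reflexive; trans to ≤-trans; antisym to ≤-antisym)
  open import Relation.Binary.Reasoning.StrictPartialOrder strictPartialOrder

  x<y⇒0<y-x : ∀ {x y} → x < y → 0# < y - x
  x<y⇒0<y-x {x} x<y = <-respˡ-≈ (-‿inverseʳ x) (+-mono-< (- x) x<y)

  0<y-x⇒x<y : ∀ {x y} → 0# < y - x → x < y
  0<y-x⇒x<y {x} {y} 0<y-x = <-respˡ-≈ (+-identityˡ x) (<-respʳ-≈ y-x+x≈y (+-mono-< x 0<y-x))
    where
    y-x+x≈y : y - x + x ≈ y
    y-x+x≈y = begin-equality
      y - x + x     ≈⟨ +-assoc y (- x) x ⟩
      y + (- x + x) ≈⟨ +-congˡ (-‿inverseˡ x) ⟩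
      y + 0#        ≈⟨ +-identityʳ y ⟩
      y             ∎

  -‿antimono-< : ∀ {x y} → x < y → - y < - x
  -‿antimono-< {x} {y} x<y = 0<y-x⇒x<y (<-respʳ-≈ y-x≈-x--y (x<y⇒0<y-x x<y))
    where
    y-x≈-x--y : y - x ≈ - x - - y
    y-x≈-x--y = trans (+-comm y (- x)) (+-congˡ (sym (-‿involutive y)))

  -‿antimono-≤ : ∀ {x y} → x ≤ y → - y ≤ - x
  -‿antimono-≤ (inj₁ x<y) = inj₁ (-‿antimono-< x<y)
  -‿antimono-≤ (inj₂ x≈y) = inj₂ (-‿cong (sym x≈y))

  +-monoʳ-≤ : ∀ z {x y} → x ≤ y → z + x ≤ z + y
  +-monoʳ-≤ z (inj₁ x<y) = inj₁ (<-respˡ-≈ (+-comm _ z) (<-respʳ-≈ (+-comm _ z) (+-mono-< z x<y)))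
  +-monoʳ-≤ z (inj₂ x≈y) = inj₂ (+-congˡ x≈y)

  +-mono-≤ : ∀ {x y u v} → x ≤ y → u ≤ v → x + u ≤ y + v
  +-mono-≤ {x} {y} {u} {v} x≤y u≤v = begin
    x + u ≤⟨ +-monoʳ-≤ x u≤v ⟩
    x + v ≈⟨ +-comm x v ⟩
    v + x ≤⟨ +-monoʳ-≤ v x≤y ⟩
    v + y ≈⟨ +-comm v y ⟩
    y + v ∎

  0<1 : 0# < 1#
  0<1 with compare 0# 1#
  ... | tri< 0<1′ _ _ = 0<1′
  ... | tri≈ _ 0≈1 _ = ⊥-elim (0≉1 0≈1)
  ... | tri> _ _ 1<0 = ⊥-elim (<-irrefl refl (begin-strict
    0#            <⟨ *-pos 0<-1 0<-1 ⟩
    - 1# * - 1#   ≈⟨ -1*x≈-x (- 1#) ⟩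
    - - 1#        ≈⟨ -‿involutive 1# ⟩
    1#            <⟨ 1<0 ⟩
    0#            ∎))
    where
    0<-1 : 0# < - 1#
    0<-1 = <-respˡ-≈ -0#≈0# (-‿antimono-< 1<0)

  *-monoʳ-< : ∀ {x y z} → 0# < z → x < y → x * z < y * z
  *-monoʳ-< {x} {y} {z} 0<z x<y =
    0<y-x⇒x<y (<-respʳ-≈ ([y-z]x≈yx-zx z y x) (*-pos (x<y⇒0<y-x x<y) 0<z))

  *-monoʳ-≤ : ∀ {x y z} → 0# ≤ z → x ≤ y → x * z ≤ y * z
  *-monoʳ-≤ (inj₁ 0<z) (inj₁ x<y) = inj₁ (*-monoʳ-< 0<z x<y)
  *-monoʳ-≤ _          (inj₂ x≈y) = inj₂ (*-congʳ x≈y)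
  *-monoʳ-≤ {x} {y} {z} (inj₂ 0≈z) (inj₁ _) = inj₂ (begin-equality
    x * z  ≈⟨ *-congˡ 0≈z ⟨
    x * 0# ≈⟨ zeroʳ x ⟩
    0#     ≈⟨ zeroʳ y ⟨
    y * 0# ≈⟨ *-congˡ 0≈z ⟩
    y * z  ∎)

  *-monoˡ-≤ : ∀ {x y z} → 0# ≤ z → x ≤ y → z * x ≤ z * y
  *-monoˡ-≤ 0≤z x≤y = ≤-respʳ-≈ (*-comm _ _) (≤-respˡ-≈ (*-comm _ _) (*-monoʳ-≤ 0≤z x≤y))

  *-cancelʳ-≤ : ∀ {x y z} → 0# < z → x * z ≤ y * z → x ≤ y
  *-cancelʳ-≤ {x} {y} {z} 0<z xz≤yz with compare x y
  ... | tri< x<y _ _ = inj₁ x<y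
  ... | tri≈ _ x≈y _ = inj₂ x≈y
  ... | tri> _ _ y<x = ⊥-elim (<-irrefl refl (begin-strict
    x * z ≤⟨ xz≤yz ⟩
    y * z <⟨ *-monoʳ-< 0<z y<x ⟩
    x * z ∎))

  <⇒≉ : ∀ {x y} → x < y → x ≉ y
  <⇒≉ x<y x≈y = <-irrefl x≈y x<y

  square-mono : ∀ {x y} → 0# ≤ x → x ≤ y → x * x ≤ y * y
  square-mono 0≤x x≤y = ≤-trans (*-monoˡ-≤ 0≤x x≤y) (*-monoʳ-≤ (≤-trans 0≤x x≤y) x≤y)

  *-cancelʳ-≉ : ∀ {a b s} → a ≉ b → a * s ≈ b * s → s ≈ 0#
  *-cancelʳ-≉ {a} {b} {s} a≉b as≈bs with inverse (a - b) (a≉b ∘ x∙y⁻¹≈ε⇒x≈y a b)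
  ... | d , [a-b]d≈1 = begin-equality
    s                   ≈⟨ *-identityˡ s ⟨
    1# * s              ≈⟨ *-congʳ [a-b]d≈1 ⟨
    (a - b) * d * s     ≈⟨ *-congʳ (*-comm (a - b) d) ⟩
    d * (a - b) * s     ≈⟨ *-assoc d (a - b) s ⟩
    d * ((a - b) * s)   ≈⟨ *-congˡ ([y-z]x≈yx-zx s a b) ⟩
    d * (a * s - b * s) ≈⟨ *-congˡ (x≈y⇒x∙y⁻¹≈ε as≈bs) ⟩
    d * 0#              ≈⟨ zeroʳ d ⟩
    0#                  ∎

  infix 4 _∈[±_]

  _∈[±_] : Carrier → Carrier → Set (ℓ₁ Level.⊔ ℓ₂)
  a ∈[± b ] = (- b ≤ a) × (a ≤ b)

  ∈[±]-resp : ∀ {a a′ b} → a ≈ a′ → a ∈[± b ] → a′ ∈[± b ]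
  ∈[±]-resp a≈a′ (lo , hi) = ≤-respʳ-≈ a≈a′ lo , ≤-respˡ-≈ a≈a′ hi

  ∈[±]-weaken : ∀ {a b b′} → a ∈[± b ] → b ≤ b′ → a ∈[± b′ ]
  ∈[±]-weaken (lo , hi) b≤b′ = ≤-trans (-‿antimono-≤ b≤b′) lo , ≤-trans hi b≤b′

  ∈[±]-neg : ∀ {a b} → a ∈[± b ] → - a ∈[± b ]
  ∈[±]-neg (lo , hi) = -‿antimono-≤ hi , ≤-respʳ-≈ (-‿involutive _) (-‿antimono-≤ lo)

  ∈[±]⇒0≤ : ∀ {a b} → a ∈[± b ] → 0# ≤ b
  ∈[±]⇒0≤ {a} {b} (lo , hi) with total 0# b
  ... | inj₁ 0≤b = 0≤b
  ... | inj₂ b≤0 = begin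
    0#   ≈⟨ -0#≈0# ⟨
    - 0# ≤⟨ -‿antimono-≤ b≤0 ⟩
    - b  ≤⟨ lo ⟩
    a    ≤⟨ hi ⟩
    b    ∎

  ∈[±0]⇒≈0 : ∀ {a} → a ∈[± 0# ] → a ≈ 0#
  ∈[±0]⇒≈0 (lo , hi) = ≤-antisym hi (≤-respˡ-≈ -0#≈0# lo)

  ∈[±]-*-cancelʳ : ∀ {a b z} → 0# < z → a * z ∈[± b * z ] → a ∈[± b ]
  ∈[±]-*-cancelʳ {b = b} {z} 0<z (lo , hi) =
    *-cancelʳ-≤ 0<z (≤-respˡ-≈ (-‿distribˡ-* b z) lo) , *-cancelʳ-≤ 0<z hi

  ∈[±]⇒square≤ : ∀ {a b} → a ∈[± b ] → a * a ≤ b * b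
  ∈[±]⇒square≤ {a} a∈ with total 0# a
  ... | inj₁ 0≤a = square-mono 0≤a (proj₂ a∈)
  ... | inj₂ a≤0 = ≤-respˡ-≈ -a*-a≈a*a (square-mono 0≤-a (proj₂ (∈[±]-neg a∈)))
    where
    0≤-a : 0# ≤ - a
    0≤-a = ≤-respˡ-≈ -0#≈0# (-‿antimono-≤ a≤0)
    -a*-a≈a*a : - a * - a ≈ a * a
    -a*-a≈a*a = begin-equality
      - a * - a     ≈⟨ -‿distribˡ-* a (- a) ⟨
      - (a * - a)   ≈⟨ -‿cong (-‿distribʳ-* a a) ⟨
      - - (a * a)   ≈⟨ -‿involutive (a * a) ⟩
      a * a         ∎

  open import Algebra.Construct.NaturalChoice.Max totalOrder using (_⊔_; x≤x⊔y; x≤y⊔x; ⊔-sel)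
  open import Data.List.Extrema totalOrder using (argmax; f[xs]≤f[argmax])

  ∣_∣ : Carrier → Carrier
  ∣ a ∣ = a ⊔ - a

  ∈[±∣∣] : ∀ a → a ∈[± ∣ a ∣ ]
  ∈[±∣∣] a = ≤-respʳ-≈ (-‿involutive a) (-‿antimono-≤ (x≤y⊔x a (- a))) , x≤x⊔y a (- a)

  dominant-entry : ∀ {n} (x : Fin n → Carrier) → ¬ (∀ i → x i ≈ 0#) →
                   ∃[ p ] (0# < ∣ x p ∣ × ∀ j → x j ∈[± ∣ x p ∣ ])
  dominant-entry {zero}  x x≉0 = ⊥-elim (x≉0 λ ())
  dominant-entry {suc n} x x≉0 = p , positive (∈[±]⇒0≤ (dominated p)) , dominated
    where
    p : Fin (suc n)
    p = argmax (∣_∣ ∘ x) zero (allFin (suc n))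
    dominated : ∀ j → x j ∈[± ∣ x p ∣ ]
    dominated j = ∈[±]-weaken (∈[±∣∣] (x j))
      (All.lookup (f[xs]≤f[argmax] {f = ∣_∣ ∘ x} zero (allFin (suc n))) (∈-allFin j))
    positive : 0# ≤ ∣ x p ∣ → 0# < ∣ x p ∣
    positive (inj₁ 0<∣xp∣) = 0<∣xp∣
    positive (inj₂ 0≈∣xp∣) =
      ⊥-elim (x≉0 λ j → ∈[±0]⇒≈0 (∈[±]-weaken (dominated j) (≤-reflexive (sym 0≈∣xp∣))))

  sum-mono-≤ : ∀ {n} {f g : Fin n → Carrier} → (∀ i → f i ≤ g i) → sum f ≤ sum g
  sum-mono-≤ {zero}  f≤g = ≤-refl
  sum-mono-≤ {suc n} f≤g = +-mono-≤ (f≤g zero) (sum-mono-≤ (f≤g ∘ suc))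

  module _ {n} (B : Fin n → Fin n → Carrier) {b} (B≥0 : ∀ i j → 0# ≤ B i j)
           (row-sum : ∀ i → sum (B i) ≈ b) where

    mulVec-∈[±] : ∀ {x : Fin n → Carrier} {M} → (∀ j → x j ∈[± M ]) →
                  ∀ i → sum (λ j → B i j * x j) ∈[± b * M ]
    mulVec-∈[±] {x} {M} x∈ i = lower , upper
      where
      sum-scaled-row : ∀ y → sum (λ j → B i j * y) ≈ b * y
      sum-scaled-row y = trans (sym (*-distribʳ-sum y (B i))) (*-congʳ (row-sum i))
      lower : - (b * M) ≤ sum (λ j → B i j * x j)
      lower = begin
        - (b * M)               ≈⟨ -‿distribʳ-* b M ⟩
        b * - M                 ≈⟨ sum-scaled-row (- M) ⟨
        sum (λ j → B i j * - M) ≤⟨ sum-mono-≤ (λ j → *-monoˡ-≤ (B≥0 i j) (proj₁ (x∈ j))) ⟩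
        sum (λ j → B i j * x j) ∎
      upper : sum (λ j → B i j * x j) ≤ b * M
      upper = begin
        sum (λ j → B i j * x j) ≤⟨ sum-mono-≤ (λ j → *-monoˡ-≤ (B≥0 i j) (proj₂ (x∈ j))) ⟩
        sum (λ j → B i j * M)   ≈⟨ sum-scaled-row M ⟩
        b * M                   ∎

    eigenvalue-∈[±row-sum] : ∀ {μ} (x : Fin n → Carrier) → ¬ (∀ i → x i ≈ 0#) →
                             (∀ i → sum (λ j → B i j * x j) ≈ μ * x i) → μ ∈[± b ]
    eigenvalue-∈[±row-sum] {μ} x x≉0 eigen with dominant-entry x x≉0
    ... | p , 0<∣xp∣ , dominated = ∈[±]-*-cancelʳ 0<∣xp∣ (μ∣xp∣∈ (⊔-sel (x p) (- x p)))
      where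
      μxp∈ : μ * x p ∈[± b * ∣ x p ∣ ]
      μxp∈ = ∈[±]-resp (eigen p) (mulVec-∈[±] dominated p)
      μ∣xp∣∈ : ∣ x p ∣ ≈ x p ⊎ ∣ x p ∣ ≈ - x p → μ * ∣ x p ∣ ∈[± b * ∣ x p ∣ ]
      μ∣xp∣∈ (inj₁ ∣xp∣≈xp)  = ∈[±]-resp (*-congˡ (sym ∣xp∣≈xp)) μxp∈
      μ∣xp∣∈ (inj₂ ∣xp∣≈-xp) =
        ∈[±]-resp (trans (-‿distribʳ-* μ (x p)) (*-congˡ (sym ∣xp∣≈-xp))) (∈[±]-neg μxp∈)

  fromℕ-+ : ∀ m n → fromℕ (m ℕ.+ n) ≈ fromℕ m + fromℕ n
  fromℕ-+ zero    n = sym (+-identityˡ (fromℕ n))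
  fromℕ-+ (suc m) n = trans (+-congˡ (fromℕ-+ m n)) (sym (+-assoc 1# (fromℕ m) (fromℕ n)))

  fromℕ-* : ∀ m n → fromℕ (m ℕ.* n) ≈ fromℕ m * fromℕ n
  fromℕ-* zero    n = sym (zeroˡ (fromℕ n))
  fromℕ-* (suc m) n = begin-equality
    fromℕ (n ℕ.+ m ℕ.* n)              ≈⟨ fromℕ-+ n (m ℕ.* n) ⟩
    fromℕ n + fromℕ (m ℕ.* n)          ≈⟨ +-cong (sym (*-identityˡ (fromℕ n))) (fromℕ-* m n) ⟩
    1# * fromℕ n + fromℕ m * fromℕ n   ≈⟨ distribʳ (fromℕ n) 1# (fromℕ m) ⟨
    (1# + fromℕ m) * fromℕ n           ∎

  0≤fromℕ : ∀ m → 0# ≤ fromℕ m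
  0≤fromℕ zero    = ≤-refl
  0≤fromℕ (suc m) = ≤-respˡ-≈ (+-identityˡ 0#) (+-mono-≤ (inj₁ 0<1) (0≤fromℕ m))

  fromℕ-mono : ∀ {m n} → m ℕ.≤ n → fromℕ m ≤ fromℕ n
  fromℕ-mono {n = n} ℕ.z≤n = 0≤fromℕ n
  fromℕ-mono (s≤s m≤n)      = +-monoʳ-≤ 1# (fromℕ-mono m≤n)

  fromℕ-sum : ∀ {n} (f : Fin n → ℕ) → fromℕ (ℕΣ.sum f) ≈ sum (fromℕ ∘ f)
  fromℕ-sum {zero}  f = refl
  fromℕ-sum {suc n} f = trans (fromℕ-+ (f zero) _) (+-congˡ (fromℕ-sum (f ∘ suc)))

  ∈[±fromℕ]⇒square≤ : ∀ {a m N} → a ∈[± fromℕ m ] → m ℕ.* m ℕ.≤ N → a * a ≤ fromℕ N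
  ∈[±fromℕ]⇒square≤ {a} {m} {N} a∈ m²≤N = begin
    a * a                 ≤⟨ ∈[±]⇒square≤ a∈ ⟩
    fromℕ m * fromℕ m     ≈⟨ fromℕ-* m m ⟨
    fromℕ (m ℕ.* m)       ≤⟨ fromℕ-mono m²≤N ⟩
    fromℕ N               ∎

χ : Bool → ℕ
χ b = if b then 1 else 0

degree≡sum : ∀ {n} (G : Graph n) i → degree G i ≡ ℕΣ.sum (χ ∘ adj G i)
degree≡sum {n} G i = foldr-map-allFin ℕ._+_ 0 n (χ ∘ adj G i)

sum-const : ∀ n m → ℕΣ.sum {n} (λ _ → m) ≡ n ℕ.* m
sum-const zero    m = ≡.refl
sum-const (suc n) m = cong (m ℕ.+_) (sum-const n m)

count+count-not : ∀ {n} (f : Fin n → Bool) → ℕΣ.sum (χ ∘ f) ℕ.+ ℕΣ.sum (χ ∘ not ∘ f) ≡ n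
count+count-not {n} f = begin
  ℕΣ.sum (χ ∘ f) ℕ.+ ℕΣ.sum (χ ∘ not ∘ f)       ≡⟨ ℕΣ.∑-distrib-+ (χ ∘ f) (χ ∘ not ∘ f) ⟨
  ℕΣ.sum (λ j → χ (f j) ℕ.+ χ (not (f j)))     ≡⟨ ℕΣ.sum-cong-≗ (χ+χ∘not ∘ f) ⟩
  ℕΣ.sum {n} (λ _ → 1)                          ≡⟨ sum-const n 1 ⟩
  n ℕ.* 1                                       ≡⟨ ℕ.*-identityʳ n ⟩
  n                                             ∎
  where
  open ≡.≡-Reasoning
  χ+χ∘not : ∀ b → χ b ℕ.+ χ (not b) ≡ 1
  χ+χ∘not true  = ≡.refl
  χ+χ∘not false = ≡.refl

non-degree≡ : ∀ {n} (G : Graph n) {R} → Regular G R → ∀ i → ℕΣ.sum (χ ∘ not ∘ adj G i) ≡ n ∸ R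
non-degree≡ {n} G {R} regular i = begin
  non-deg                        ≡⟨ ℕ.m+n∸m≡n R non-deg ⟨
  R ℕ.+ non-deg ∸ R              ≡⟨ cong (λ m → m ℕ.+ non-deg ∸ R) (≡.trans (≡.sym (regular i)) (degree≡sum G i)) ⟩
  ℕΣ.sum (χ ∘ adj G i) ℕ.+ non-deg ∸ R ≡⟨ cong (_∸ R) (count+count-not (adj G i)) ⟩
  n ∸ R                          ∎
  where
  open ≡.≡-Reasoning
  non-deg : ℕ
  non-deg = ℕΣ.sum (χ ∘ not ∘ adj G i)

module RegularGraphSpectrum {c ℓ₁ ℓ₂} (F : OrderedField c ℓ₁ ℓ₂) where
  open OrderedField F hiding (_<_; _≤_; zero)
  open OrderedFieldProperties F
  open import Algebra.Properties.Ring ring using (-‿distribˡ-*; -‿involutive; +-inverseʳ-unique)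
  open import Relation.Binary.Reasoning.Setoid setoid

  indicator : Bool → Carrier
  indicator b = if b then 1# else 0#

  fromℕ-χ : ∀ b → fromℕ (χ b) ≈ indicator b
  fromℕ-χ true  = +-identityʳ 1#
  fromℕ-χ false = refl

  indicator+indicator-not : ∀ b → indicator b + indicator (not b) ≈ 1#
  indicator+indicator-not true  = +-identityʳ 1#
  indicator+indicator-not false = +-identityˡ 1#

  0≤indicator : ∀ b → 0# ≤ indicator b
  0≤indicator true  = inj₁ 0<1
  0≤indicator false = ≤-refl

  sum-indicator : ∀ {n} (f : Fin n → Bool) → sum (indicator ∘ f) ≈ fromℕ (ℕΣ.sum (χ ∘ f))
  sum-indicator f = sym (trans (fromℕ-sum (χ ∘ f)) (sum-cong-≋ (fromℕ-χ ∘ f)))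

  module _ {n} (G : Graph n) {R} (regular : Regular G R) where

    A : Fin n → Fin n → Carrier
    A = adjMatrix F G

    nonAdjMatrix : Fin n → Fin n → Carrier
    nonAdjMatrix i j = indicator (not (adj G i j))

    adj-row-sum : ∀ i → sum (A i) ≈ fromℕ R
    adj-row-sum i = trans (sum-indicator (adj G i))
      (reflexive (cong fromℕ (≡.trans (≡.sym (degree≡sum G i)) (regular i))))

    adj-column-sum : ∀ j → sum (λ i → A i j) ≈ fromℕ R
    adj-column-sum j = trans (sum-cong-≋ λ i → reflexive (cong indicator (symmetric G i j))) (adj-row-sum j)

    nonAdj-row-sum : ∀ i → sum (nonAdjMatrix i) ≈ fromℕ (n ∸ R)
    nonAdj-row-sum i = trans (sum-indicator (not ∘ adj G i))
      (reflexive (cong fromℕ (non-degree≡ G regular i)))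

    module _ {l} {x : Fin n → Carrier} (eigen : ∀ i → sum (λ j → A i j * x j) ≈ l * x i) where

      eigenvector-sum≈0 : l ≉ fromℕ R → sum x ≈ 0#
      eigenvector-sum≈0 l≉R = *-cancelʳ-≉ l≉R (begin
        l * sum x                            ≈⟨ *-distribˡ-sum l x ⟩
        sum (λ i → l * x i)                  ≈⟨ sum-cong-≋ eigen ⟨
        sum (λ i → sum (λ j → A i j * x j))  ≈⟨ ∑-comm (λ i j → A i j * x j) ⟩
        sum (λ j → sum (λ i → A i j * x j))  ≈⟨ sum-cong-≋ (λ j → *-distribʳ-sum (x j) (λ i → A i j)) ⟨
        sum (λ j → sum (λ i → A i j) * x j)  ≈⟨ sum-cong-≋ (λ j → *-congʳ (adj-column-sum j)) ⟩
        sum (λ j → fromℕ R * x j)            ≈⟨ *-distribˡ-sum (fromℕ R) x ⟨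
        fromℕ R * sum x                      ∎)

      nonAdj-eigen : sum x ≈ 0# → ∀ i → sum (λ j → nonAdjMatrix i j * x j) ≈ - l * x i
      nonAdj-eigen Σx≈0 i = begin
        sum (λ j → nonAdjMatrix i j * x j) ≈⟨ +-inverseʳ-unique _ _ Ax+Nx≈0 ⟩
        - sum (λ j → A i j * x j)          ≈⟨ -‿cong (eigen i) ⟩
        - (l * x i)                        ≈⟨ -‿distribˡ-* l (x i) ⟩
        - l * x i                          ∎
        where
        A+N≈1 : ∀ j → A i j * x j + nonAdjMatrix i j * x j ≈ x j
        A+N≈1 j = begin
          A i j * x j + nonAdjMatrix i j * x j ≈⟨ distribʳ (x j) _ _ ⟨
          (A i j + nonAdjMatrix i j) * x j     ≈⟨ *-congʳ (indicator+indicator-not (adj G i j)) ⟩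
          1# * x j                             ≈⟨ *-identityˡ (x j) ⟩
          x j                                  ∎
        Ax+Nx≈0 : sum (λ j → A i j * x j) + sum (λ j → nonAdjMatrix i j * x j) ≈ 0#
        Ax+Nx≈0 = trans (sym (∑-distrib-+ (λ j → A i j * x j) (λ j → nonAdjMatrix i j * x j)))
          (trans (sum-cong-≋ A+N≈1) Σx≈0)

    eigenvalue-∈[±] : ∀ {l} → l ≉ fromℕ R → IsEigenvalue F G l → l ∈[± fromℕ (n ∸ R) ]
    eigenvalue-∈[±] {l} l≉R (x , x≉0 , eigen′) = ∈[±]-resp (-‿involutive l) (∈[±]-neg
      (eigenvalue-∈[±row-sum] nonAdjMatrix (λ i j → 0≤indicator _) nonAdj-row-sum x x≉0
        (nonAdj-eigen eigen (eigenvector-sum≈0 eigen l≉R))))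
      where
      eigen : ∀ i → sum (λ j → A i j * x j) ≈ l * x i
      eigen i = ≡.subst (_≈ l * x i) (foldr-map-allFin _+_ 0# n _) (eigen′ i)

    eigenvalue-square≤ : ∀ {l N} → l ≉ fromℕ R → IsEigenvalue F G l →
                         (n ∸ R) ℕ.* (n ∸ R) ℕ.≤ N → l * l ≤ fromℕ N
    eigenvalue-square≤ l≉R l-eigen = ∈[±fromℕ]⇒square≤ {m = n ∸ R} (eigenvalue-∈[±] l≉R l-eigen)

sum-if-≟ : ∀ {d} (a : Fin (suc d)) m m′ →
           ℕΣ.sum (λ b → if does (a ≟ b) then m else m′) ≡ m ℕ.+ d ℕ.* m′
sum-if-≟ {d}     zero    m m′ = cong (m ℕ.+_) (sum-const d m′)
sum-if-≟ {suc d} (suc a) m m′ = ≡.trans (cong (m′ ℕ.+_) (sum-if-≟ a m m′)) (x∙yz≈y∙xz m′ m (d ℕ.* m′))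
  where open import Algebra.Properties.CommutativeSemigroup ℕ.+-commutativeSemigroup using (x∙yz≈y∙xz)

module _ {k} (G : Graph k) {r} (regular : Regular G r) where

  join-row-sum : ∀ (same-copy : Bool) u →
                 ℕΣ.sum (λ v → χ (if same-copy then adj G u v else true)) ≡ (if same-copy then r else k)
  join-row-sum true  u = ≡.trans (≡.sym (degree≡sum G u)) (regular u)
  join-row-sum false u = ≡.trans (sum-const k 1) (ℕ.*-identityʳ k)

  join-regular : ∀ d → Regular (join (suc d) G) (r ℕ.+ d ℕ.* k)
  join-regular d x = begin
    degree (join (suc d) G) x                               ≡⟨ degree≡sum (join (suc d) G) x ⟩
    ℕΣ.sum (λ y → χ (jadj G x′ (remQuot {suc d} k y)))       ≡⟨ sum-remQuot (suc d) (χ ∘ jadj G x′) ⟩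
    ℕΣ.sum (λ b → ℕΣ.sum (λ v → χ (jadj G x′ (b , v))))     ≡⟨ ℕΣ.sum-cong-≗ (λ b → join-row-sum (does (a ≟ b)) u) ⟩
    ℕΣ.sum (λ b → if does (a ≟ b) then r else k)            ≡⟨ sum-if-≟ a r k ⟩
    r ℕ.+ d ℕ.* k                                           ∎
    where
    open ≡.≡-Reasoning
    open MonoidSum ℕ.+-0-monoid using (sum-remQuot)
    x′ : Fin (suc d) × Fin k
    x′ = remQuot {suc d} k x
    a : Fin (suc d)
    a = proj₁ x′
    u : Fin k
    u = proj₂ x′

join-edge : ∀ {d k} (G : Graph k) {x y : Fin (d ℕ.* k)} →
            quotient {d} k x ≢ quotient {d} k y → Edge (join d G) x y
join-edge {d} {k} G {x} {y} x≁y =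
  cong (λ same-copy → if same-copy then adj G (proj₂ (remQuot {d} k x)) (proj₂ (remQuot {d} k y)) else true)
       (dec-false (quotient {d} k x ≟ quotient {d} k y) x≁y)

join-connected : ∀ {d k} (G : Graph k) → Connected (join (2 ℕ.+ d) G)
join-connected {d} {k} G x y with quotient {2 ℕ.+ d} k x ≟ quotient {2 ℕ.+ d} k y
... | no  x≁y = join-edge G x≁y ◅ ε
... | yes x∼y = join-edge G x≁z ◅ join-edge G z≁y ◅ ε
  where
  a : Fin (2 ℕ.+ d)
  a = quotient {2 ℕ.+ d} k x
  z : Fin ((2 ℕ.+ d) ℕ.* k)
  z = combine (punchIn a zero) (proj₂ (remQuot {2 ℕ.+ d} k x))
  quotient-z : quotient {2 ℕ.+ d} k z ≡ punchIn a zero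
  quotient-z = cong proj₁ (remQuot-combine {2 ℕ.+ d} {k} (punchIn a zero) _)
  x≁z : a ≢ quotient {2 ℕ.+ d} k z
  x≁z a≡z = punchInᵢ≢i a zero (≡.sym (≡.trans a≡z quotient-z))
  z≁y : quotient {2 ℕ.+ d} k z ≢ quotient {2 ℕ.+ d} k y
  z≁y z≡y = punchInᵢ≢i a zero (≡.trans (≡.sym quotient-z) (≡.trans z≡y (≡.sym x∼y)))

join-non-degree≤ : ∀ k r d → suc d ℕ.* k ∸ (r ℕ.+ d ℕ.* k) ℕ.≤ k
join-non-degree≤ k r d = begin
  (k ℕ.+ d ℕ.* k) ∸ (r ℕ.+ d ℕ.* k) ≤⟨ ℕ.∸-monoʳ-≤ (k ℕ.+ d ℕ.* k) (ℕ.m≤n+m (d ℕ.* k) r) ⟩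
  (k ℕ.+ d ℕ.* k) ∸ d ℕ.* k         ≡⟨ ℕ.m+n∸n≡m k (d ℕ.* k) ⟩
  k                                 ∎
  where open ℕ.≤-Reasoning

k²≤join-degree∸1 : ∀ k r d → k ℕ.* k ℕ.≤ d → k ℕ.* k ℕ.≤ r ℕ.+ suc d ℕ.* k ∸ 1
k²≤join-degree∸1 zero    r d _    = ℕ.z≤n
k²≤join-degree∸1 (suc k) r d k²≤d = ℕ.∸-monoˡ-≤ 1 (begin
  suc (suc k ℕ.* suc k)     ≤⟨ s≤s k²≤d ⟩
  suc d                     ≤⟨ ℕ.m≤m*n (suc d) (suc k) ⟩
  suc d ℕ.* suc k           ≤⟨ ℕ.m≤n+m _ r ⟩
  r ℕ.+ suc d ℕ.* suc k     ∎)
  where open ℕ.≤-Reasoning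

join-non-degree²≤4[degree∸1] : ∀ k r d → k ℕ.* k ℕ.≤ d →
  let c = suc (suc d) ℕ.* k ∸ (r ℕ.+ suc d ℕ.* k) in c ℕ.* c ℕ.≤ 4 ℕ.* (r ℕ.+ suc d ℕ.* k ∸ 1)
join-non-degree²≤4[degree∸1] k r d k²≤d = begin
  c ℕ.* c                        ≤⟨ ℕ.*-mono-≤ (join-non-degree≤ k r (suc d)) (join-non-degree≤ k r (suc d)) ⟩
  k ℕ.* k                        ≤⟨ k²≤join-degree∸1 k r d k²≤d ⟩
  r ℕ.+ suc d ℕ.* k ∸ 1          ≤⟨ ℕ.m≤n*m _ 4 ⟩
  4 ℕ.* (r ℕ.+ suc d ℕ.* k ∸ 1)  ∎
  where
  open ℕ.≤-Reasoning
  c : ℕ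
  c = suc (suc d) ℕ.* k ∸ (r ℕ.+ suc d ℕ.* k)

corollary19 : ∀ {k : ℕ} (G : Graph k) (r : ℕ) → Regular G r →
    ∃[ d₀ ] (∀ (d : ℕ) → 1 ℕ.≤ d → d₀ ℕ.≤ d →
      (F : OrderedField 0ℓ 0ℓ 0ℓ) → IsRamanujan F (join d G))
corollary19 {k} G r regular = 2 ℕ.+ k ℕ.* k , ramanujan
  where
  ramanujan : ∀ d → 1 ℕ.≤ d → 2 ℕ.+ k ℕ.* k ℕ.≤ d → (F : OrderedField 0ℓ 0ℓ 0ℓ) → IsRamanujan F (join d G)
  ramanujan (suc (suc d)) _ (s≤s (s≤s k²≤d)) F =
    join-connected {d} G , r ℕ.+ suc d ℕ.* k , join-regular G regular (suc d) ,
    λ l l-eigen _ l<R → eigenvalue-square≤ (join (2 ℕ.+ d) G) (join-regular G regular (suc d))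
      (<⇒≉ l<R) l-eigen (join-non-degree²≤4[degree∸1] k r d k²≤d)
    where
    open OrderedFieldProperties F using (<⇒≉)
    open RegularGraphSpectrum F using (eigenvalue-square≤)
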